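{- The maximum of $\sigma_2(G)$ over all connected graphs $G$ with $n$ vertices is $n^4/32+O(n^3)$.
   Context: Graphs are finite, simple and undirected. For a connected graph $G$ and vertex $u$, $\varepsilon_G(u)=\max_{v\in V(G)}d_G(u,v)$ is the eccentricity of $u$, and $\sigma_2(G)=\sum_{uv\in E(G)}\varepsilon_G(u)\varepsilon_G(v)$ is the second Zagreb eccentricity index. -}

module Defs where

open import Data.Bool using (Bool; true; false; _∧_; _∨_; T; if_then_else_)
open import Data.Nat using (ℕ; zero; suc; _+_; _*_; _⊔_; _<ᵇ_)
open import Data.Fin using (Fin; toℕ; _≟_)
open import Data.List using (List; []; _∷_; map; foldr; allFin; concatMap)
open import Data.Bool.ListAction using (any)
open import Data.Nat.ListAction using (sum)
open import Data.Product using (∃-syntax)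
open import Relation.Nullary.Decidable using (⌊_⌋)
open import Relation.Binary.PropositionalEquality using (_≡_)

record Graph (n : ℕ) : Set where
  field
    adj    : Fin n → Fin n → Bool
    sym    : ∀ u v → adj u v ≡ adj v u
    irrefl : ∀ u → adj u u ≡ false
open Graph public

data Walk {n : ℕ} (G : Graph n) : Fin n → Fin n → ℕ → Set where
  here : ∀ {u} → Walk G u u 0
  step : ∀ {u w v k} → T (adj G u w) → Walk G w v k → Walk G u v (suc k)

Connected : ∀ {n} → Graph n → Set
Connected {n} G = ∀ (u v : Fin n) → ∃[ k ] Walk G u v k

reach : ∀ {n} → Graph n → ℕ → Fin n → Fin n → Bool
reach G zero    u v = ⌊ u ≟ v ⌋
reach {n} G (suc k) u v = reach G k u v ∨ any (λ w → adj G u w ∧ reach G k w v) (allFin n)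

search : (ℕ → Bool) → ℕ → ℕ → ℕ
search p k zero       = k
search p k (suc fuel) = if p k then k else search p (suc k) fuel

-- Distance d_G(u,v): least length of a u–v walk (= shortest path length).
-- In a connected graph on n vertices it is < n, so the search bound n suffices.
dist : ∀ {n} → Graph n → Fin n → Fin n → ℕ
dist {n} G u v = search (λ k → reach G k u v) 0 n

ecc : ∀ {n} → Graph n → Fin n → ℕ
ecc {n} G u = foldr _⊔_ 0 (map (dist G u) (allFin n))

σ₂ : ∀ {n} → Graph n → ℕ
σ₂ {n} G = sum (concatMap (λ i → map (λ j →
  if (toℕ i <ᵇ toℕ j) ∧ adj G i j then ecc G i * ecc G j else 0) (allFin n)) (allFin n))

-- Upper bound: every eccentricity is at most the diameter D, which is the length of
-- a shortest walk P on D + 1 distinct vertices. A vertex is adjacent to at most three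
-- vertices of P, as otherwise P could be shortcut, so apart from the Q = n − D − 1
-- vertices off P, which span at most Q²/2 edges, there are at most 6n edges. Hence
-- 32 σ₂ ≤ 16 D² Q² + O(n³) ≤ (D + Q)⁴ + O(n³) by AM–GM.
-- Lower bound: in the lollipop graph made of a clique on ⌊n/2⌋ vertices and a path
-- through all n vertices, each clique vertex has eccentricity at least ⌈n/2⌉, so the
-- clique edges alone give σ₂ ≥ ⌈n/2⌉² ⌊n/2⌋ (⌊n/2⌋ − 1)/2 = n⁴/32 − O(n³).

module Submission where

open import Data.Bool using (Bool; true; false; T; _∧_; _∨_; if_then_else_)
open import Data.Bool.Properties using (T-∧; T-∨; ∧-assoc; ∧-comm; ∧-zeroʳ)
open import Data.Empty using (⊥-elim)
open import Data.Fin using (Fin; toℕ; fromℕ; fromℕ<; _≟_) renaming (zero to fzero; suc to fsuc)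
open import Data.Fin.Properties using (toℕ<n; toℕ-fromℕ; toℕ-fromℕ<; toℕ-injective; suc-injective; 0≢1+n; injective⇒≤)
open import Data.List using (List; []; _∷_; map; foldr; tabulate; allFin; concatMap)
open import Data.List.Membership.Propositional using (_∈_; lose)
open import Data.List.Membership.Propositional.Properties using (∈-allFin; ∈-map⁺; ∈-map⁻; foldr-selective)
open import Data.List.Properties using (foldr-preservesᵒ)
open import Data.List.Relation.Unary.Any using (satisfied)
open import Data.List.Relation.Unary.Any.Properties using (any⁺; any⁻)
open import Data.Nat
  using (ℕ; zero; suc; _+_; _*_; _∸_; _^_; _⊔_; _≤_; _<_; _<ᵇ_; _≡ᵇ_; ∣_-_∣; z≤n; s≤s; s≤s⁻¹; _<?_; ⌊_/2⌋; ⌈_/2⌉)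
open import Data.Nat.Properties hiding (_≟_; suc-injective; 0≢1+n)
open import Data.Nat.ListAction using () renaming (sum to sumˡ)
open import Data.Nat.ListAction.Properties using (sum-++)
open import Data.Nat.Tactic.RingSolver using (solve-∀)
open import Data.Product using (Σ-syntax; ∃-syntax; _×_; _,_; proj₁; proj₂)
open import Data.Sum using (_⊎_; inj₁; inj₂; [_,_]′)
open import Data.Unit using (tt)
open import Function using (_∘_; Injective; Equivalence)
open import Relation.Binary.PropositionalEquality
open import Relation.Nullary using (does; yes; no; contradiction)
open import Relation.Nullary.Decidable using (dec-false; toWitness; fromWitness)
open import Algebra.Properties.Semiring.Sum +-*-semiring
  using (sum; sum-syntax; ∑-comm; ∑-distrib-+; *-distribˡ-sum; *-distribʳ-sum; sum-cong-≗; sum-replicate-zero)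

open import Defs hiding (sym)

open ≤-Reasoning

-- Iverson brackets and sums over Fin

⟦_⟧ : Bool → ℕ
⟦ true ⟧  = 1
⟦ false ⟧ = 0

⟦⟧-idem : ∀ b → ⟦ b ⟧ * ⟦ b ⟧ ≡ ⟦ b ⟧
⟦⟧-idem true  = refl
⟦⟧-idem false = refl

⟦⟧*-mono-≤ : ∀ a b {x y} → (T a → T b × x ≤ y) → ⟦ a ⟧ * x ≤ ⟦ b ⟧ * y
⟦⟧*-mono-≤ false b     _ = z≤n
⟦⟧*-mono-≤ true  true  h = +-monoˡ-≤ 0 (proj₂ (h tt))
⟦⟧*-mono-≤ true  false h = ⊥-elim (proj₁ (h tt))

if-then-0 : ∀ b x → (if b then x else 0) ≡ ⟦ b ⟧ * x
if-then-0 true  x = sym (+-identityʳ x)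
if-then-0 false x = refl

⟦∧⟧ : ∀ a b → ⟦ a ∧ b ⟧ ≡ ⟦ a ⟧ * ⟦ b ⟧
⟦∧⟧ true  b = sym (+-identityʳ ⟦ b ⟧)
⟦∧⟧ false b = refl

⟦∧⟧≤-split : ∀ a b {x y} → x ≤ 1 → y ≤ 1 → ⟦ a ∧ b ⟧ ≤ ⟦ a ⟧ * ((1 ∸ x) * (1 ∸ y)) + ⟦ b ⟧ * x + ⟦ b ⟧ * y
⟦∧⟧≤-split false b           _         _         = z≤n
⟦∧⟧≤-split true  false       _         _         = z≤n
⟦∧⟧≤-split true  true        z≤n       z≤n       = s≤s z≤n
⟦∧⟧≤-split true  true        z≤n       (s≤s z≤n) = s≤s z≤n
⟦∧⟧≤-split true  true        (s≤s z≤n) _         = s≤s z≤n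

∑-mono-≤ : ∀ {n} {f g : Fin n → ℕ} → (∀ i → f i ≤ g i) → sum f ≤ sum g
∑-mono-≤ {zero}  _   = z≤n
∑-mono-≤ {suc n} f≤g = +-mono-≤ (f≤g fzero) (∑-mono-≤ (f≤g ∘ fsuc))

∑-const : ∀ n c → ∑[ i < n ] c ≡ n * c
∑-const zero    c = refl
∑-const (suc n) c = cong (c +_) (∑-const n c)

∑-*ˡ : ∀ {n} c (f : Fin n → ℕ) → ∑[ i < n ] (c * f i) ≡ c * sum f
∑-*ˡ c f = sym (*-distribˡ-sum c f)

∑-*ʳ : ∀ {n} c (f : Fin n → ℕ) → ∑[ i < n ] (f i * c) ≡ sum f * c
∑-*ʳ c f = sym (*-distribʳ-sum c f)

sumˡ-map-tabulate : ∀ {A : Set} {n} (e : Fin n → A) (f : A → ℕ) →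
                    sumˡ (map f (tabulate e)) ≡ ∑[ i < n ] f (e i)
sumˡ-map-tabulate {n = zero}  e f = refl
sumˡ-map-tabulate {n = suc n} e f = cong (f (e fzero) +_) (sumˡ-map-tabulate (e ∘ fsuc) f)

sumˡ-concatMap : ∀ {A : Set} (F : A → List ℕ) xs → sumˡ (concatMap F xs) ≡ sumˡ (map (sumˡ ∘ F) xs)
sumˡ-concatMap F []       = refl
sumˡ-concatMap F (x ∷ xs) = trans (sum-++ (F x) (concatMap F xs)) (cong (sumˡ (F x) +_) (sumˡ-concatMap F xs))

∑-select : ∀ {n} (c : Fin n) (f : Fin n → ℕ) → ∑[ j < n ] (⟦ does (c ≟ j) ⟧ * f j) ≡ f c
∑-select {suc n} fzero f = begin-equality
  f fzero + 0 + ∑[ j < n ] 0  ≡⟨ cong₂ _+_ (+-identityʳ _) (sum-replicate-zero n) ⟩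
  f fzero + 0                 ≡⟨ +-identityʳ _ ⟩
  f fzero                     ∎
∑-select {suc n} (fsuc c) f = ∑-select c (f ∘ fsuc)

∑-⟦≟⟧ : ∀ {n} (c : Fin n) → ∑[ j < n ] ⟦ does (c ≟ j) ⟧ ≡ 1
∑-⟦≟⟧ {n} c = trans (sum-cong-≗ {n} (λ j → sym (*-identityʳ ⟦ does (c ≟ j) ⟧))) (∑-select c (λ _ → 1))

⟦<ᵇ⟧-trichotomy : ∀ {n} (i j : Fin n) → ⟦ toℕ i <ᵇ toℕ j ⟧ + ⟦ toℕ j <ᵇ toℕ i ⟧ + ⟦ does (i ≟ j) ⟧ ≡ 1
⟦<ᵇ⟧-trichotomy fzero    fzero    = refl
⟦<ᵇ⟧-trichotomy fzero    (fsuc j) = refl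
⟦<ᵇ⟧-trichotomy (fsuc i) fzero    = refl
⟦<ᵇ⟧-trichotomy (fsuc i) (fsuc j) = ⟦<ᵇ⟧-trichotomy i j

∑-⟦<ᵇ⟧ : ∀ {n} h → h ≤ n → ∑[ i < n ] ⟦ toℕ i <ᵇ h ⟧ ≡ h
∑-⟦<ᵇ⟧ {n}     zero    _         = sum-replicate-zero n
∑-⟦<ᵇ⟧ {suc n} (suc h) (s≤s h≤n) = cong suc (∑-⟦<ᵇ⟧ h h≤n)

count-injective : ∀ {k n} {g : Fin k → Fin n} → Injective _≡_ _≡_ g →
                  ∀ j → ∑[ t < k ] ⟦ does (g t ≟ j) ⟧ ≤ 1
count-injective {zero}              _   j = z≤n
count-injective {suc k} {g = g} inj j with g fzero ≟ j
... | no  _    = count-injective (suc-injective ∘ inj) j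
... | yes refl = s≤s (≤-reflexive (trans (sum-cong-≗ {k} miss) (sum-replicate-zero k)))
  where
  miss : ∀ t → ⟦ does (g (fsuc t) ≟ g fzero) ⟧ ≡ 0
  miss t = cong ⟦_⟧ (dec-false (g (fsuc t) ≟ g fzero) (0≢1+n ∘ sym ∘ inj))

count-below : ∀ {k} (b : Fin k → Bool) w → (∀ t → T (b t) → toℕ t < w) → ∑[ t < k ] ⟦ b t ⟧ ≤ w
count-below {zero}  b w       _     = z≤n
count-below {suc k} b w below with b fzero in eq
count-below {suc k} b zero    below | true  = contradiction (below fzero (subst T (sym eq) tt)) λ ()
count-below {suc k} b (suc w) below | true  = s≤s (count-below (b ∘ fsuc) w (λ t → s≤s⁻¹ ∘ below (fsuc t)))
count-below {suc k} b w       below | false =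
  count-below (b ∘ fsuc) w (λ t bt → <-trans (n<1+n (toℕ t)) (below (fsuc t) bt))

count-clustered : ∀ {k} (b : Fin k → Bool) d →
                  (∀ {t t'} → T (b t) → T (b t') → toℕ t' ≤ toℕ t + d) → ∑[ t < k ] ⟦ b t ⟧ ≤ suc d
count-clustered {zero}  b d _  = z≤n
count-clustered {suc k} b d cl with b fzero in eq
... | true  = s≤s (count-below (b ∘ fsuc) d (λ t → cl (subst T (sym eq) tt)))
... | false = count-clustered (b ∘ fsuc) d (λ bt bt' → s≤s⁻¹ (cl bt bt'))

∑∑-distrib-+ : ∀ {m n} (f g : Fin m → Fin n → ℕ) →
               ∑[ i < m ] ∑[ j < n ] (f i j + g i j) ≡ ∑[ i < m ] ∑[ j < n ] f i j + ∑[ i < m ] ∑[ j < n ] g i j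
∑∑-distrib-+ {m} {n} f g = trans (sum-cong-≗ {m} (λ i → ∑-distrib-+ {n} (f i) (g i))) (∑-distrib-+ {m} _ _)

pairSum : ∀ {n} → (Fin n → ℕ) → ℕ
pairSum {n} f = ∑[ i < n ] ∑[ j < n ] (⟦ toℕ i <ᵇ toℕ j ⟧ * (f i * f j))

pairSum-square : ∀ {n} (f : Fin n → ℕ) → 2 * pairSum f + ∑[ i < n ] (f i * f i) ≡ sum f * sum f
pairSum-square {n} f = begin-equality
  2 * pairSum f + ∑[ i < n ] (f i * f i)
    ≡⟨ cong (λ x → pairSum f + x + ∑[ i < n ] (f i * f i)) (trans (+-identityʳ (pairSum f)) (sym lower≡upper)) ⟩
  pairSum f + ∑∑ lower + ∑[ i < n ] (f i * f i)
    ≡⟨ cong (pairSum f + ∑∑ lower +_) (sym (sum-cong-≗ {n} (λ i → ∑-select i (λ j → f i * f j)))) ⟩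
  pairSum f + ∑∑ lower + ∑∑ diagonal
    ≡⟨ sym (trans (∑∑-distrib-+ _ diagonal) (cong (_+ ∑∑ diagonal) (∑∑-distrib-+ upper lower))) ⟩
  ∑[ i < n ] ∑[ j < n ] (upper i j + lower i j + diagonal i j)
    ≡⟨ sum-cong-≗ {n} (λ i → sum-cong-≗ {n} (λ j → split i j)) ⟩
  ∑[ i < n ] ∑[ j < n ] (f i * f j)
    ≡⟨ sum-cong-≗ {n} (λ i → ∑-*ˡ (f i) f) ⟩
  ∑[ i < n ] (f i * sum f)
    ≡⟨ ∑-*ʳ (sum f) f ⟩
  sum f * sum f ∎
  where
  ∑∑ : (Fin n → Fin n → ℕ) → ℕ
  ∑∑ h = ∑[ i < n ] ∑[ j < n ] h i j
  upper lower diagonal : Fin n → Fin n → ℕ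
  upper    i j = ⟦ toℕ i <ᵇ toℕ j ⟧ * (f i * f j)
  lower    i j = ⟦ toℕ j <ᵇ toℕ i ⟧ * (f i * f j)
  diagonal i j = ⟦ does (i ≟ j) ⟧ * (f i * f j)
  lower≡upper : ∑∑ lower ≡ pairSum f
  lower≡upper = trans (∑-comm lower) (sum-cong-≗ {n} λ j → sum-cong-≗ {n} λ i →
    cong (⟦ toℕ j <ᵇ toℕ i ⟧ *_) (*-comm (f i) (f j)))
  split : ∀ i j → upper i j + lower i j + diagonal i j ≡ f i * f j
  split i j = begin-equality
    upper i j + lower i j + diagonal i j
      ≡⟨ distribʳ₃ ⟦ toℕ i <ᵇ toℕ j ⟧ ⟦ toℕ j <ᵇ toℕ i ⟧ ⟦ does (i ≟ j) ⟧ (f i * f j) ⟩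
    (⟦ toℕ i <ᵇ toℕ j ⟧ + ⟦ toℕ j <ᵇ toℕ i ⟧ + ⟦ does (i ≟ j) ⟧) * (f i * f j)
      ≡⟨ cong (_* (f i * f j)) (⟦<ᵇ⟧-trichotomy i j) ⟩
    1 * (f i * f j)
      ≡⟨ *-identityˡ _ ⟩
    f i * f j ∎
    where
    distribʳ₃ : ∀ a b c x → a * x + b * x + c * x ≡ (a + b + c) * x
    distribʳ₃ = solve-∀

-- Walks, reachability and distance

≤-max : ∀ {x xs} → x ∈ xs → x ≤ foldr _⊔_ 0 xs
≤-max x∈xs = foldr-preservesᵒ ⊔-preserves-≤ 0 _ (inj₂ (lose x∈xs ≤-refl))
  where
  ⊔-preserves-≤ : ∀ {x} a b → x ≤ a ⊎ x ≤ b → x ≤ a ⊔ b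
  ⊔-preserves-≤ a b = [ (λ x≤a → ≤-trans x≤a (m≤m⊔n a b)) , (λ x≤b → ≤-trans x≤b (m≤n⊔m a b)) ]′

max-attained : ∀ {A : Set} (f : A → ℕ) (x₀ : A) xs → ∃[ x ] foldr _⊔_ 0 (map f xs) ≤ f x
max-attained f x₀ xs with foldr-selective ⊔-sel 0 (map f xs)
... | inj₁ max≡0 = x₀ , ≤-trans (≤-reflexive max≡0) z≤n
... | inj₂ max∈ with ∈-map⁻ f max∈
...   | x , _ , max≡fx = x , ≤-reflexive max≡fx

search-≤ : ∀ p {a} fuel {j} → T (p j) → a ≤ j → search p a fuel ≤ j
search-≤ p zero        _   a≤j = a≤j
search-≤ p {a} (suc fuel) {j} pj a≤j with p a in eq
... | true  = a≤j
... | false with m≤n⇒m<n∨m≡n a≤j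
...   | inj₁ a<j  = search-≤ p fuel pj a<j
...   | inj₂ refl = contradiction (subst T eq pj) λ ()

search-sound : ∀ p a fuel → search p a fuel < a + fuel → T (p (search p a fuel))
search-sound p a zero       s<a+0 = contradiction (subst (a <_) (+-identityʳ a) s<a+0) (<-irrefl refl)
search-sound p a (suc fuel) s<    with p a in eq
... | true  = subst T (sym eq) tt
... | false = search-sound p (suc a) fuel (subst (search p (suc a) fuel <_) (+-suc a fuel) s<)

module _ {n} {G : Graph n} where

  adj-sym : ∀ {u v} → T (adj G u v) → T (adj G v u)
  adj-sym {u} {v} = subst T (Graph.sym G u v)

  _++ʷ_ : ∀ {u v w k l} → Walk G u v k → Walk G v w l → Walk G u w (k + l)
  here     ++ʷ q = q
  step e p ++ʷ q = step e (p ++ʷ q)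

  reverseʷ : ∀ {u v k} → Walk G u v k → Walk G v u k
  reverseʷ here                 = here
  reverseʷ (step {k = k} e p) = subst (Walk G _ _) (+-comm k 1) (reverseʷ p ++ʷ step (adj-sym e) here)

  hub-connected : (r : Fin n) → (∀ u → ∃[ k ] Walk G u r k) → Connected G
  hub-connected r to-r u v = _ , proj₂ (to-r u) ++ʷ reverseʷ (proj₂ (to-r v))

  vertexAt : ∀ {u v m} → Walk G u v m → ℕ → Fin n
  vertexAt {u} here       _       = u
  vertexAt {u} (step _ p) zero    = u
  vertexAt     (step _ p) (suc t) = vertexAt p t

  prefix : ∀ {u v m} (p : Walk G u v m) t → t ≤ m → Walk G u (vertexAt p t) t
  prefix here       zero    z≤n       = here
  prefix (step _ p) zero    _         = here
  prefix (step e p) (suc t) (s≤s t≤m) = step e (prefix p t t≤m)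

  suffix : ∀ {u v m} (p : Walk G u v m) t → t ≤ m → Walk G (vertexAt p t) v (m ∸ t)
  suffix here       zero    z≤n       = here
  suffix (step e p) zero    _         = step e p
  suffix (step _ p) (suc t) (s≤s t≤m) = suffix p t t≤m

  Shortest : ∀ {u v m} → Walk G u v m → Set
  Shortest {u} {v} {m} _ = ∀ {l} → Walk G u v l → m ≤ l

  module _ {u v m} (p : Walk G u v m) (shortest : Shortest p) {t t'} (t≤m : t ≤ m) (t'≤m : t' ≤ m) where

    shortest-no-shortcut : ∀ {c} → Walk G (vertexAt p t) (vertexAt p t') c → t' ≤ t + c
    shortest-no-shortcut {c} shortcut = +-cancelʳ-≤ (m ∸ t') t' (t + c) (begin
      t' + (m ∸ t')       ≡⟨ m+[n∸m]≡n t'≤m ⟩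
      m                   ≤⟨ shortest (prefix p t t≤m ++ʷ (shortcut ++ʷ suffix p t' t'≤m)) ⟩
      t + (c + (m ∸ t'))  ≡⟨ +-assoc t c (m ∸ t') ⟨
      t + c + (m ∸ t')    ∎)

    shortest-common-neighbour : ∀ {y} → T (adj G y (vertexAt p t)) → T (adj G y (vertexAt p t')) → t' ≤ t + 2
    shortest-common-neighbour yt yt' = shortest-no-shortcut (step (adj-sym yt) (step yt' here))

  shortest-vertexAt-injective : ∀ {u v m} (p : Walk G u v m) → Shortest p → ∀ {t t'} → t ≤ m → t' ≤ m →
                                vertexAt p t ≡ vertexAt p t' → t ≡ t'
  shortest-vertexAt-injective p shortest {t} {t'} t≤m t'≤m same = ≤-antisym
    (subst (t ≤_) (+-identityʳ t') (shortest-no-shortcut p shortest t'≤m t≤m back))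
    (subst (t' ≤_) (+-identityʳ t) (shortest-no-shortcut p shortest t≤m t'≤m forth))
    where
    back : Walk G (vertexAt p t') (vertexAt p t) 0
    back = subst (λ x → Walk G x (vertexAt p t) 0) same here
    forth : Walk G (vertexAt p t) (vertexAt p t') 0
    forth = subst (λ x → Walk G (vertexAt p t) x 0) same here

  reach-complete : ∀ {k u v m} → Walk G u v m → m ≤ k → T (reach G k u v)
  reach-complete {zero}          here       z≤n       = fromWitness refl
  reach-complete {suc k} {u}     here       _         =
    Equivalence.from (T-∨ {reach G k u u}) (inj₁ (reach-complete {k} here z≤n))
  reach-complete {suc k} {u} {v} (step e q) (s≤s m≤k) = Equivalence.from (T-∨ {reach G k u v})
    (inj₂ (any⁺ (λ w → adj G u w ∧ reach G k w v) (lose (∈-allFin _) (Equivalence.from T-∧ (e , reach-complete q m≤k)))))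

  reach-sound : ∀ k {u v} → T (reach G k u v) → ∃[ m ] m ≤ k × Walk G u v m
  reach-sound zero    r with toWitness r
  ... | refl = 0 , z≤n , here
  reach-sound (suc k) r with Equivalence.to T-∨ r
  ... | inj₁ r′ with reach-sound k r′
  ...   | m , m≤k , p = m , m≤n⇒m≤1+n m≤k , p
  reach-sound (suc k) r | inj₂ r′ with satisfied (any⁻ _ (allFin n) r′)
  ...   | w , uw∧r with Equivalence.to T-∧ uw∧r
  ...     | e , r″ with reach-sound k r″
  ...       | m , m≤k , p = suc m , s≤s m≤k , step e p

  dist-minimal : ∀ {u v l} → Walk G u v l → dist G u v ≤ l
  dist-minimal p = search-≤ _ n (reach-complete p ≤-refl) z≤n

  -- The search behind dist gives up at n, hence the hypothesis c ≤ n.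
  ≤-dist : ∀ {u v c} → (∀ {l} → Walk G u v l → c ≤ l) → c ≤ n → c ≤ dist G u v
  ≤-dist {u} {v} lower c≤n with dist G u v <? n
  ... | yes d<n = let m , m≤d , p = reach-sound _ (search-sound _ 0 n d<n) in ≤-trans (lower p) m≤d
  ... | no  d≮n = ≤-trans c≤n (≮⇒≥ d≮n)

  shortest-walk : ∀ {u v k} → Walk G u v k → ∃[ m ] Σ[ p ∈ Walk G u v m ] Shortest p
  shortest-walk {u} {v} {k} q =
    let m , m≤j , p = reach-sound j (search-sound reach? 0 (suc k) (s≤s j≤k))
    in m , p , λ r → ≤-trans m≤j (search-≤ reach? (suc k) (reach-complete r ≤-refl) z≤n)
    where
    reach? : ℕ → Bool
    reach? l = reach G l u v
    j : ℕ
    j = search reach? 0 (suc k)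
    j≤k : j ≤ k
    j≤k = search-≤ reach? (suc k) (reach-complete q ≤-refl) z≤n

-- Eccentricities, edge counts and σ₂

diametral-pair : ∀ {n} (G : Graph (suc n)) → ∃[ u ] ∃[ v ] ∀ i → ecc G i ≤ dist G u v
diametral-pair {n} G =
  let u , max≤ecc-u = max-attained (ecc G) fzero (allFin (suc n))
      v , ecc-u≤d   = max-attained (dist G u) u (allFin (suc n))
  in u , v , λ i → ≤-trans (≤-max (∈-map⁺ (ecc G) (∈-allFin i))) (≤-trans max≤ecc-u ecc-u≤d)

module _ {n} (G : Graph n) where

  dist≤ecc : ∀ u v → dist G u v ≤ ecc G u
  dist≤ecc u v = ≤-max (∈-map⁺ (dist G u) (∈-allFin v))

  edge : Fin n → Fin n → Bool
  edge i j = (toℕ i <ᵇ toℕ j) ∧ adj G i j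

  size : ℕ
  size = ∑[ i < n ] ∑[ j < n ] ⟦ edge i j ⟧

  σ₂-as-∑ : σ₂ G ≡ ∑[ i < n ] ∑[ j < n ] (⟦ edge i j ⟧ * (ecc G i * ecc G j))
  σ₂-as-∑ = begin-equality
    σ₂ G                                        ≡⟨ sumˡ-concatMap row (allFin n) ⟩
    sumˡ (map (sumˡ ∘ row) (allFin n))          ≡⟨ sumˡ-map-tabulate (λ i → i) (sumˡ ∘ row) ⟩
    ∑[ i < n ] sumˡ (row i)                     ≡⟨ sum-cong-≗ {n} (λ i → sumˡ-map-tabulate (λ j → j) (term i)) ⟩
    ∑[ i < n ] ∑[ j < n ] term i j              ≡⟨ sum-cong-≗ {n} (λ i → sum-cong-≗ {n} (λ j → if-then-0 (edge i j) _)) ⟩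
    ∑[ i < n ] ∑[ j < n ] (⟦ edge i j ⟧ * (ecc G i * ecc G j)) ∎
    where
    term : Fin n → Fin n → ℕ
    term i j = if edge i j then ecc G i * ecc G j else 0
    row : Fin n → List ℕ
    row i = map (term i) (allFin n)

  σ₂≤size*ecc² : ∀ {D} → (∀ i → ecc G i ≤ D) → σ₂ G ≤ size * (D * D)
  σ₂≤size*ecc² {D} ecc≤D = begin
    σ₂ G
      ≡⟨ σ₂-as-∑ ⟩
    ∑[ i < n ] ∑[ j < n ] (⟦ edge i j ⟧ * (ecc G i * ecc G j))
      ≤⟨ ∑-mono-≤ (λ i → ∑-mono-≤ (λ j → ⟦⟧*-mono-≤ (edge i j) (edge i j) (λ e → e , *-mono-≤ (ecc≤D i) (ecc≤D j)))) ⟩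
    ∑[ i < n ] ∑[ j < n ] (⟦ edge i j ⟧ * (D * D))
      ≡⟨ sum-cong-≗ {n} (λ i → ∑-*ʳ (D * D) (λ j → ⟦ edge i j ⟧)) ⟩
    ∑[ i < n ] (∑[ j < n ] ⟦ edge i j ⟧ * (D * D))
      ≡⟨ ∑-*ʳ (D * D) (λ i → ∑[ j < n ] ⟦ edge i j ⟧) ⟩
    size * (D * D) ∎

  clique-pairs*ecc²≤σ₂ : ∀ (S : Fin n → Bool) {c} →
    (∀ {i j} → T (S i) → T (S j) → toℕ i < toℕ j → T (adj G i j)) →
    (∀ {i} → T (S i) → c ≤ ecc G i) →
    pairSum (⟦_⟧ ∘ S) * (c * c) ≤ σ₂ G
  clique-pairs*ecc²≤σ₂ S {c} clique far = begin
    pairSum (⟦_⟧ ∘ S) * (c * c)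
      ≡⟨ ∑-*ʳ (c * c) (λ i → ∑[ j < n ] inClique i j) ⟨
    ∑[ i < n ] (∑[ j < n ] inClique i j * (c * c))
      ≡⟨ sum-cong-≗ {n} (λ i → ∑-*ʳ (c * c) (inClique i)) ⟨
    ∑[ i < n ] ∑[ j < n ] (inClique i j * (c * c))
      ≤⟨ ∑-mono-≤ (λ i → ∑-mono-≤ (λ j → term-≤ i j)) ⟩
    ∑[ i < n ] ∑[ j < n ] (⟦ edge i j ⟧ * (ecc G i * ecc G j))
      ≡⟨ σ₂-as-∑ ⟨
    σ₂ G ∎
    where
    inClique : Fin n → Fin n → ℕ
    inClique i j = ⟦ toℕ i <ᵇ toℕ j ⟧ * (⟦ S i ⟧ * ⟦ S j ⟧)
    term-≤ : ∀ i j → inClique i j * (c * c) ≤ ⟦ edge i j ⟧ * (ecc G i * ecc G j)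
    term-≤ i j = subst (λ x → x * (c * c) ≤ _)
      (trans (⟦∧⟧ (toℕ i <ᵇ toℕ j) _) (cong (⟦ toℕ i <ᵇ toℕ j ⟧ *_) (⟦∧⟧ (S i) (S j))))
      (⟦⟧*-mono-≤ ((toℕ i <ᵇ toℕ j) ∧ (S i ∧ S j)) (edge i j) λ t →
        let i<j , Si∧Sj = Equivalence.to T-∧ t
            Si , Sj = Equivalence.to T-∧ Si∧Sj
        in Equivalence.from T-∧ (i<j , clique Si Sj (<ᵇ⇒< _ _ i<j)) , *-mono-≤ (far Si) (far Sj))

module _ {n k} (G : Graph n) {g : Fin k → Fin n} (g-injective : Injective _≡_ _≡_ g) where

  hits misses : Fin n → ℕ
  hits   j = ∑[ t < k ] ⟦ does (g t ≟ j) ⟧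
  misses j = 1 ∸ hits j

  ∑-hits : sum hits ≡ k
  ∑-hits = begin-equality
    ∑[ j < n ] ∑[ t < k ] ⟦ does (g t ≟ j) ⟧  ≡⟨ ∑-comm (λ j t → ⟦ does (g t ≟ j) ⟧) ⟩
    ∑[ t < k ] ∑[ j < n ] ⟦ does (g t ≟ j) ⟧  ≡⟨ sum-cong-≗ {k} (λ t → ∑-⟦≟⟧ (g t)) ⟩
    ∑[ t < k ] 1                              ≡⟨ trans (∑-const k 1) (*-identityʳ k) ⟩
    k                                         ∎

  ∑-misses : sum misses ≡ n ∸ k
  ∑-misses = sym (begin-equality
    n ∸ k                               ≡⟨ cong (_∸ k) ∑[misses+hits] ⟨
    ∑[ j < n ] (misses j + hits j) ∸ k  ≡⟨ cong (_∸ k) (trans (∑-distrib-+ {n} misses hits) (cong (sum misses +_) ∑-hits)) ⟩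
    sum misses + k ∸ k                  ≡⟨ m+n∸n≡m (sum misses) k ⟩
    sum misses                          ∎)
    where
    ∑[misses+hits] : ∑[ j < n ] (misses j + hits j) ≡ n
    ∑[misses+hits] = begin-equality
      ∑[ j < n ] (misses j + hits j)  ≡⟨ sum-cong-≗ {n} (λ j → m∸n+n≡m (count-injective g-injective j)) ⟩
      ∑[ j < n ] 1                    ≡⟨ trans (∑-const n 1) (*-identityʳ n) ⟩
      n                               ∎

  ∑-adj*hits : ∀ y → ∑[ j < n ] (⟦ adj G y j ⟧ * hits j) ≡ ∑[ t < k ] ⟦ adj G y (g t) ⟧
  ∑-adj*hits y = begin-equality
    ∑[ j < n ] (⟦ adj G y j ⟧ * hits j)
      ≡⟨ sum-cong-≗ {n} (λ j → ∑-*ˡ ⟦ adj G y j ⟧ (λ t → ⟦ does (g t ≟ j) ⟧)) ⟨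
    ∑[ j < n ] ∑[ t < k ] (⟦ adj G y j ⟧ * ⟦ does (g t ≟ j) ⟧)
      ≡⟨ ∑-comm (λ j t → ⟦ adj G y j ⟧ * ⟦ does (g t ≟ j) ⟧) ⟩
    ∑[ t < k ] ∑[ j < n ] (⟦ adj G y j ⟧ * ⟦ does (g t ≟ j) ⟧)
      ≡⟨ sum-cong-≗ {k} (λ t → trans (sum-cong-≗ {n} (λ j → *-comm ⟦ adj G y j ⟧ _)) (∑-select (g t) (λ j → ⟦ adj G y j ⟧))) ⟩
    ∑[ t < k ] ⟦ adj G y (g t) ⟧ ∎

  hitEdges : ℕ
  hitEdges = ∑[ i < n ] ∑[ j < n ] (⟦ adj G i j ⟧ * hits j)

  hitEdges≤ : ∀ {w} → (∀ y → ∑[ t < k ] ⟦ adj G y (g t) ⟧ ≤ w) → hitEdges ≤ n * w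
  hitEdges≤ {w} few-neighbours = begin
    hitEdges                                  ≡⟨ sum-cong-≗ {n} ∑-adj*hits ⟩
    ∑[ i < n ] ∑[ t < k ] ⟦ adj G i (g t) ⟧   ≤⟨ ∑-mono-≤ few-neighbours ⟩
    ∑[ i < n ] w                              ≡⟨ ∑-const n w ⟩
    n * w                                     ∎

  -- An edge avoiding the image of g joins two missed vertices; any other edge is
  -- counted in hitEdges through an endpoint in the image, read from either side.
  size≤pairs+hitEdges : size G ≤ pairSum misses + hitEdges + hitEdges
  size≤pairs+hitEdges = begin
    size G
      ≤⟨ ∑-mono-≤ (λ i → ∑-mono-≤ (λ j → ⟦∧⟧≤-split (toℕ i <ᵇ toℕ j) (adj G i j)
            (count-injective g-injective i) (count-injective g-injective j))) ⟩
    ∑[ i < n ] ∑[ j < n ] (bothMissed i j + firstHit i j + secondHit i j)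
      ≡⟨ trans (∑∑-distrib-+ (λ i j → bothMissed i j + firstHit i j) secondHit)
               (cong (_+ hitEdges) (trans (∑∑-distrib-+ bothMissed firstHit) (cong (pairSum misses +_) swap))) ⟩
    pairSum misses + hitEdges + hitEdges ∎
    where
    bothMissed firstHit secondHit : Fin n → Fin n → ℕ
    bothMissed i j = ⟦ toℕ i <ᵇ toℕ j ⟧ * (misses i * misses j)
    firstHit   i j = ⟦ adj G i j ⟧ * hits i
    secondHit  i j = ⟦ adj G i j ⟧ * hits j
    swap : ∑[ i < n ] ∑[ j < n ] firstHit i j ≡ hitEdges
    swap = trans (∑-comm firstHit)
                 (sum-cong-≗ {n} λ j → sum-cong-≗ {n} λ i → cong (λ b → ⟦ b ⟧ * hits i) (Graph.sym G i j))

  size≤ : ∀ {w} → (∀ y → ∑[ t < k ] ⟦ adj G y (g t) ⟧ ≤ w) → 2 * size G ≤ (n ∸ k) * (n ∸ k) + 4 * (n * w)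
  size≤ {w} few-neighbours = begin
    2 * size G                                          ≤⟨ *-monoʳ-≤ 2 size≤pairs+hitEdges ⟩
    2 * (pairSum misses + hitEdges + hitEdges)          ≡⟨ regroup (pairSum misses) hitEdges ⟩
    2 * pairSum misses + 4 * hitEdges                   ≤⟨ +-mono-≤ pairs≤ (*-monoʳ-≤ 4 (hitEdges≤ few-neighbours)) ⟩
    (n ∸ k) * (n ∸ k) + 4 * (n * w)                     ∎
    where
    regroup : ∀ p e → 2 * (p + e + e) ≡ 2 * p + 4 * e
    regroup = solve-∀
    pairs≤ : 2 * pairSum misses ≤ (n ∸ k) * (n ∸ k)
    pairs≤ = begin
      2 * pairSum misses                                    ≤⟨ m≤m+n _ _ ⟩
      2 * pairSum misses + ∑[ j < n ] (misses j * misses j) ≡⟨ pairSum-square misses ⟩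
      sum misses * sum misses                               ≡⟨ cong₂ _*_ ∑-misses ∑-misses ⟩
      (n ∸ k) * (n ∸ k)                                     ∎

-- Upper bound

4xy≤[x+y]² : ∀ x y → 4 * x * y ≤ (x + y) * (x + y)
4xy≤[x+y]² x y = [ ordered , (λ y≤x → subst₂ _≤_ (swap y x) (cong (λ z → z * z) (+-comm y x)) (ordered y≤x)) ]′ (≤-total x y)
  where
  expand : ∀ a d → 4 * a * (a + d) + d * d ≡ (a + (a + d)) * (a + (a + d))
  expand = solve-∀
  swap : ∀ a b → 4 * a * b ≡ 4 * b * a
  swap = solve-∀
  ordered : ∀ {a b} → a ≤ b → 4 * a * b ≤ (a + b) * (a + b)
  ordered {a} a≤b with d , refl ← m≤n⇒∃[o]m+o≡n a≤b = subst (4 * a * (a + d) ≤_) (expand a d) (m≤m+n _ (d * d))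

upper-arith : ∀ {n D Q E σ} → D + Q ≤ n → σ ≤ E * (D * D) → 2 * E ≤ Q * Q + 4 * (n * 3) →
              32 * σ ≤ n ^ 4 + 192 * n ^ 3
upper-arith {n} {D} {Q} {E} {σ} D+Q≤n σ≤ 2E≤ = begin
  32 * σ                                          ≤⟨ *-monoʳ-≤ 32 σ≤ ⟩
  32 * (E * (D * D))                              ≡⟨ regroup E D ⟩
  16 * (D * D) * (2 * E)                          ≤⟨ *-monoʳ-≤ (16 * (D * D)) 2E≤ ⟩
  16 * (D * D) * (Q * Q + 4 * (n * 3))            ≡⟨ expand D Q n ⟩
  (4 * D * Q) * (4 * D * Q) + 192 * (D * D * n)   ≤⟨ +-mono-≤ (*-mono-≤ amgm amgm) (*-monoʳ-≤ 192 (*-monoˡ-≤ n (*-mono-≤ D≤n D≤n))) ⟩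
  (n * n) * (n * n) + 192 * (n * n * n)           ≡⟨ powers n ⟩
  n ^ 4 + 192 * n ^ 3                             ∎
  where
  regroup : ∀ e d → 32 * (e * (d * d)) ≡ 16 * (d * d) * (2 * e)
  regroup = solve-∀
  expand : ∀ d q m → 16 * (d * d) * (q * q + 4 * (m * 3)) ≡ (4 * d * q) * (4 * d * q) + 192 * (d * d * m)
  expand = solve-∀
  powers : ∀ m → (m * m) * (m * m) + 192 * (m * m * m) ≡ m * (m * (m * (m * 1))) + 192 * (m * (m * (m * 1)))
  powers = solve-∀
  D≤n : D ≤ n
  D≤n = ≤-trans (m≤m+n D Q) D+Q≤n
  amgm : 4 * D * Q ≤ n * n
  amgm = ≤-trans (4xy≤[x+y]² D Q) (*-mono-≤ D+Q≤n D+Q≤n)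

geodesic-σ₂-bound : ∀ {n} (G : Graph n) {u v D} (P : Walk G u v D) → Shortest P → (∀ i → ecc G i ≤ D) →
                    32 * σ₂ G ≤ n ^ 4 + 192 * n ^ 3
geodesic-σ₂-bound {n} G {D = D} P shortest ecc≤D =
  upper-arith {D = D} {Q = n ∸ suc D} {E = size G} D+Q≤n (σ₂≤size*ecc² G ecc≤D) (size≤ G path-injective path-neighbours)
  where
  path : Fin (suc D) → Fin n
  path t = vertexAt P (toℕ t)
  on-path : ∀ (t : Fin (suc D)) → toℕ t ≤ D
  on-path t = s≤s⁻¹ (toℕ<n t)
  path-injective : Injective _≡_ _≡_ path
  path-injective {t} {t'} = toℕ-injective ∘ shortest-vertexAt-injective P shortest (on-path t) (on-path t')
  path-neighbours : ∀ y → ∑[ t < suc D ] ⟦ adj G y (path t) ⟧ ≤ 3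
  path-neighbours y = count-clustered (λ t → adj G y (path t)) 2
    (λ {t} {t'} → shortest-common-neighbour P shortest (on-path t) (on-path t'))
  D+Q≤n : D + (n ∸ suc D) ≤ n
  D+Q≤n = ≤-trans (n≤1+n _) (≤-reflexive (m+[n∸m]≡n (injective⇒≤ path-injective)))

upper-bound : ∀ {n} (G : Graph n) → Connected G → 32 * σ₂ G ≤ n ^ 4 + 192 * n ^ 3
upper-bound {zero}  G _ = z≤n
upper-bound {suc n} G connected =
  let u , v , ecc≤dist = diametral-pair G
      D , P , shortest = shortest-walk (proj₂ (connected u v))
  in geodesic-σ₂-bound G P shortest (λ i → ≤-trans (ecc≤dist i) (dist-minimal P))

-- Lower bound: the lollipop graph

-- The vertices below h form a clique, and the path 0 – 1 – ⋯ – (n − 1) runs through it.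
lollipopAdj : ℕ → ℕ → ℕ → Bool
lollipopAdj h a b = ((a <ᵇ h) ∧ (b <ᵇ h) ∧ (0 <ᵇ ∣ a - b ∣)) ∨ (∣ a - b ∣ ≡ᵇ 1)

lollipopAdj-sym : ∀ h a b → lollipopAdj h a b ≡ lollipopAdj h b a
lollipopAdj-sym h a b rewrite ∣-∣-comm a b = cong (_∨ (∣ b - a ∣ ≡ᵇ 1)) (∧-swap (a <ᵇ h) (b <ᵇ h) (0 <ᵇ ∣ b - a ∣))
  where
  ∧-swap : ∀ x y z → x ∧ y ∧ z ≡ y ∧ x ∧ z
  ∧-swap x y z = trans (sym (∧-assoc x y z)) (trans (cong (_∧ z) (∧-comm x y)) (∧-assoc y x z))

lollipopAdj-irrefl : ∀ h a → lollipopAdj h a a ≡ false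
lollipopAdj-irrefl h a rewrite ∣n-n∣≡0 a | ∧-zeroʳ (a <ᵇ h) | ∧-zeroʳ (a <ᵇ h) = refl

lollipop : ∀ n → ℕ → Graph n
lollipop n h = record
  { adj    = λ i j → lollipopAdj h (toℕ i) (toℕ j)
  ; sym    = λ i j → lollipopAdj-sym h (toℕ i) (toℕ j)
  ; irrefl = λ i → lollipopAdj-irrefl h (toℕ i)
  }

∣1+n-n∣≡1 : ∀ n → ∣ suc n - n ∣ ≡ 1
∣1+n-n∣≡1 zero    = refl
∣1+n-n∣≡1 (suc n) = ∣1+n-n∣≡1 n

lollipop-connected : ∀ n h → Connected (lollipop n h)
lollipop-connected zero    h ()
lollipop-connected (suc n) h = hub-connected fzero (λ i → toℕ i , walk-down (toℕ i) i refl)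
  where
  walk-down : ∀ k (i : Fin (suc n)) → toℕ i ≡ k → Walk (lollipop (suc n) h) i fzero k
  walk-down zero    i i≡0   = subst (λ x → Walk _ x fzero 0) (sym (toℕ-injective i≡0)) here
  walk-down (suc k) i i≡1+k = step i~j (walk-down k j (toℕ-fromℕ< k<1+n))
    where
    k<1+n : k < suc n
    k<1+n = <-trans (n<1+n k) (subst (_< suc n) i≡1+k (toℕ<n i))
    j : Fin (suc n)
    j = fromℕ< k<1+n
    i~j : T (lollipopAdj h (toℕ i) (toℕ j))
    i~j = Equivalence.from (T-∨ {(toℕ i <ᵇ h) ∧ (toℕ j <ᵇ h) ∧ (0 <ᵇ ∣ toℕ i - toℕ j ∣)}) (inj₂
      (subst₂ (λ a b → T (∣ a - b ∣ ≡ᵇ 1)) (sym i≡1+k) (sym (toℕ-fromℕ< k<1+n)) (≡⇒≡ᵇ _ _ (∣1+n-n∣≡1 k))))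

lollipop-clique : ∀ {n h} {i j : Fin n} → T (toℕ i <ᵇ h) → T (toℕ j <ᵇ h) → toℕ i < toℕ j → T (adj (lollipop n h) i j)
lollipop-clique i<h j<h i<j = Equivalence.from T-∨ (inj₁ (Equivalence.from T-∧ (i<h ,
  Equivalence.from T-∧ (j<h , <⇒<ᵇ (subst (0 <_) (sym (m≤n⇒∣m-n∣≡n∸m (<⇒≤ i<j))) (m<n⇒0<n∸m i<j))))))

module _ {n g : ℕ} where

  lollipop-edge-potential : ∀ a b → T (lollipopAdj (suc g) a b) → b ⊔ g ≤ suc (a ⊔ g)
  lollipop-edge-potential a b e with Equivalence.to T-∨ e
  ... | inj₁ clique = ≤-trans (≤-reflexive (m≤n⇒m⊔n≡n b≤g)) (≤-trans (m≤n⊔m a g) (n≤1+n _))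
    where
    b≤g : b ≤ g
    b≤g = s≤s⁻¹ (<ᵇ⇒< b (suc g) (proj₁ (Equivalence.to T-∧ (proj₂ (Equivalence.to (T-∧ {a <ᵇ suc g}) clique)))))
  ... | inj₂ path = ⊔-lub (≤-trans b≤1+a (s≤s (m≤m⊔n a g))) (≤-trans (m≤n⊔m a g) (n≤1+n _))
    where
    b≤1+a : b ≤ suc a
    b≤1+a = begin
      b                ≤⟨ m≤n+∣m-n∣ b a ⟩
      a + ∣ b - a ∣    ≡⟨ cong (a +_) (trans (∣-∣-comm b a) (≡ᵇ⇒≡ _ 1 path)) ⟩
      a + 1            ≡⟨ +-comm a 1 ⟩
      suc a            ∎

  lollipop-walk-potential : ∀ {u v l} → Walk (lollipop n (suc g)) u v l → toℕ v ⊔ g ≤ toℕ u ⊔ g + l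
  lollipop-walk-potential here = ≤-reflexive (sym (+-identityʳ _))
  lollipop-walk-potential {u} {v} (step {w = w} {k = l} e p) = begin
    toℕ v ⊔ g              ≤⟨ lollipop-walk-potential p ⟩
    toℕ w ⊔ g + l          ≤⟨ +-monoˡ-≤ l (lollipop-edge-potential (toℕ u) (toℕ w) e) ⟩
    suc (toℕ u ⊔ g) + l    ≡⟨ +-suc _ l ⟨
    toℕ u ⊔ g + suc l      ∎

lollipop-ecc : ∀ {n h} (i : Fin n) → T (toℕ i <ᵇ h) → n ∸ h ≤ ecc (lollipop n h) i
lollipop-ecc {suc n} {suc g} i i<h =
  ≤-trans (≤-dist far (≤-trans (m∸n≤m n g) (n≤1+n n))) (dist≤ecc (lollipop (suc n) (suc g)) i (fromℕ n))
  where
  i≤g : toℕ i ≤ g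
  i≤g = s≤s⁻¹ (<ᵇ⇒< (toℕ i) (suc g) i<h)
  far : ∀ {l} → Walk (lollipop (suc n) (suc g)) i (fromℕ n) l → n ∸ g ≤ l
  far {l} p = m≤n+o⇒m∸n≤o n g (begin
    n                      ≤⟨ m≤m⊔n n g ⟩
    n ⊔ g                  ≡⟨ cong (_⊔ g) (toℕ-fromℕ n) ⟨
    toℕ (fromℕ n) ⊔ g      ≤⟨ lollipop-walk-potential p ⟩
    toℕ i ⊔ g + l          ≡⟨ cong (_+ l) (m≤n⇒m⊔n≡n i≤g) ⟩
    g + l                  ∎)

initial-segment-pairs : ∀ {n} h → h ≤ n → 2 * pairSum {n} (λ i → ⟦ toℕ i <ᵇ h ⟧) + h ≡ h * h
initial-segment-pairs {n} h h≤n = begin-equality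
  2 * pairSum segment + h                                   ≡⟨ cong (2 * pairSum segment +_) |segment²| ⟨
  2 * pairSum segment + ∑[ i < n ] (segment i * segment i)  ≡⟨ pairSum-square segment ⟩
  sum segment * sum segment                                 ≡⟨ cong₂ _*_ |segment| |segment| ⟩
  h * h                                                     ∎
  where
  segment : Fin n → ℕ
  segment i = ⟦ toℕ i <ᵇ h ⟧
  |segment| : sum segment ≡ h
  |segment| = ∑-⟦<ᵇ⟧ h h≤n
  |segment²| : ∑[ i < n ] (segment i * segment i) ≡ h
  |segment²| = trans (sum-cong-≗ {n} (λ i → ⟦⟧-idem (toℕ i <ᵇ h))) |segment|

[h+c]²≤4hc+1 : ∀ {h c} → h ≤ c → c ≤ suc h → (h + c) * (h + c) ≤ 4 * h * c + 1
[h+c]²≤4hc+1 {h} h≤c c≤1+h with r , refl ← m≤n⇒∃[o]m+o≡n h≤c = begin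
  (h + (h + r)) * (h + (h + r))      ≡⟨ expand h r ⟩
  4 * h * (h + r) + r * r            ≤⟨ +-monoʳ-≤ (4 * h * (h + r)) (*-mono-≤ r≤1 r≤1) ⟩
  4 * h * (h + r) + 1                ∎
  where
  expand : ∀ x y → (x + (x + y)) * (x + (x + y)) ≡ 4 * x * (x + y) + y * y
  expand = solve-∀
  r≤1 : r ≤ 1
  r≤1 = +-cancelˡ-≤ h r 1 (subst (h + r ≤_) (+-comm 1 h) c≤1+h)

lower-arith : ∀ {n h c P σ} → 1 ≤ n → h + c ≡ n → h ≤ c → c ≤ suc h → 2 * P + h ≡ h * h → P * (c * c) ≤ σ →
              n ^ 4 ≤ 32 * σ + 192 * n ^ 3
lower-arith {n} {h} {c} {P} {σ} 1≤n h+c≡n h≤c c≤1+h pairs σ≥ = begin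
  n ^ 4                                                  ≡⟨ powers n ⟩
  (n * n) * (n * n)                                      ≤⟨ *-mono-≤ square square ⟩
  (4 * h * c + 1) * (4 * h * c + 1)                      ≡⟨ expand h c ⟩
  16 * (c * c) * (h * h) + (8 * (h * c) + 1)             ≡⟨ cong (λ x → 16 * (c * c) * x + (8 * (h * c) + 1)) pairs ⟨
  16 * (c * c) * (2 * P + h) + (8 * (h * c) + 1)         ≡⟨ regroup P c h ⟩
  32 * (P * (c * c)) + (16 * (c * c * h) + 8 * (h * c) + 1)
    ≤⟨ +-mono-≤ (*-monoʳ-≤ 32 σ≥) (+-mono-≤ (+-mono-≤ (*-monoʳ-≤ 16 (*-mono-≤ (*-mono-≤ c≤n c≤n) h≤n))
                                                     (*-monoʳ-≤ 8 (≤-trans (*-mono-≤ h≤n c≤n) n²≤n³))) 1≤n³) ⟩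
  32 * σ + (16 * (n * n * n) + 8 * (n * n * n) + n * n * n) ≤⟨ +-monoʳ-≤ (32 * σ) (≤-reflexive (collect n)) ⟩
  32 * σ + 25 * n ^ 3                                    ≤⟨ +-monoʳ-≤ (32 * σ) (*-monoˡ-≤ (n ^ 3) (≤ᵇ⇒≤ 25 192 tt)) ⟩
  32 * σ + 192 * n ^ 3                                   ∎
  where
  powers : ∀ m → m * (m * (m * (m * 1))) ≡ (m * m) * (m * m)
  powers = solve-∀
  expand : ∀ x y → (4 * x * y + 1) * (4 * x * y + 1) ≡ 16 * (y * y) * (x * x) + (8 * (x * y) + 1)
  expand = solve-∀
  regroup : ∀ p y x → 16 * (y * y) * (2 * p + x) + (8 * (x * y) + 1)
                     ≡ 32 * (p * (y * y)) + (16 * (y * y * x) + 8 * (x * y) + 1)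
  regroup = solve-∀
  collect : ∀ m → 16 * (m * m * m) + 8 * (m * m * m) + m * m * m ≡ 25 * (m * (m * (m * 1)))
  collect = solve-∀
  h≤n : h ≤ n
  h≤n = subst (h ≤_) h+c≡n (m≤m+n h c)
  c≤n : c ≤ n
  c≤n = subst (c ≤_) h+c≡n (m≤n+m c h)
  n²≤n³ : n * n ≤ n * n * n
  n²≤n³ = subst (_≤ n * n * n) (*-identityʳ (n * n)) (*-monoʳ-≤ (n * n) 1≤n)
  1≤n³ : 1 ≤ n * n * n
  1≤n³ = *-mono-≤ (*-mono-≤ 1≤n 1≤n) 1≤n
  square : n * n ≤ 4 * h * c + 1
  square = subst (λ m → m * m ≤ 4 * h * c + 1) h+c≡n ([h+c]²≤4hc+1 h≤c c≤1+h)

⌈n/2⌉≤1+⌊n/2⌋ : ∀ n → ⌈ n /2⌉ ≤ suc ⌊ n /2⌋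
⌈n/2⌉≤1+⌊n/2⌋ zero          = z≤n
⌈n/2⌉≤1+⌊n/2⌋ (suc zero)    = ≤-refl
⌈n/2⌉≤1+⌊n/2⌋ (suc (suc n)) = s≤s (⌈n/2⌉≤1+⌊n/2⌋ n)

lower-bound : ∀ n → 1 ≤ n → Σ[ G ∈ Graph n ] (Connected G × n ^ 4 ≤ 32 * σ₂ G + 192 * n ^ 3)
lower-bound n 1≤n = lollipop n h , lollipop-connected n h ,
  lower-arith {P = pairSum (⟦_⟧ ∘ clique)} 1≤n (⌊n/2⌋+⌈n/2⌉≡n n) (⌊n/2⌋≤⌈n/2⌉ n) (⌈n/2⌉≤1+⌊n/2⌋ n) pairs σ₂≥
  where
  h = ⌊ n /2⌋
  clique : Fin n → Bool
  clique i = toℕ i <ᵇ h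
  pairs : 2 * pairSum (⟦_⟧ ∘ clique) + h ≡ h * h
  pairs = initial-segment-pairs h (⌊n/2⌋≤n n)
  far : ∀ {i} → T (clique i) → ⌈ n /2⌉ ≤ ecc (lollipop n h) i
  far {i} i<h = subst (_≤ ecc (lollipop n h) i)
    (trans (cong (_∸ h) (sym (⌊n/2⌋+⌈n/2⌉≡n n))) (m+n∸m≡n h ⌈ n /2⌉)) (lollipop-ecc i i<h)
  σ₂≥ : pairSum (⟦_⟧ ∘ clique) * (⌈ n /2⌉ * ⌈ n /2⌉) ≤ σ₂ (lollipop n h)
  σ₂≥ = clique-pairs*ecc²≤σ₂ (lollipop n h) clique (lollipop-clique {h = h}) far

corollary2p12 : Σ[ C ∈ ℕ ] Σ[ N ∈ ℕ ] ((n : ℕ) → N ≤ n →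
    (((G : Graph n) → Connected G → 32 * σ₂ G ≤ n ^ 4 + C * n ^ 3)
    × (Σ[ G ∈ Graph n ] (Connected G × n ^ 4 ≤ 32 * σ₂ G + C * n ^ 3))))
corollary2p12 = 192 , 1 , λ n 1≤n → (λ G → upper-bound G) , lower-bound n 1≤n
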